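{- Let $K$ be a finite group of order $v$, and let $P \subseteq K$ with $1 \notin P$ be a $(v,k,\beta-1,\beta)$ partial sum set in $K$. Let $G = K \times \{1,z\}$ where $\{1,z\}$ is a cyclic group of order $2$, and set $S = P \cup Pz$ (with $Pz = \{pz : p \in P\}$). Then $S$ is a $(2v,2k,2\beta-2,2\beta)$ partial sum set in $G$ if and only if $|P \cap P^{(-1)}| = \beta$. Consequently, when $|P \cap P^{(-1)}| = \beta$, both $S \cup \{1\}$ and $S \cup \{z\}$ are $(2v,2k+1,2\beta)$ sum sets in $G$ which are type 2 with respect to $N = \{1,z\}$.
   Context: For a finite group $X$ of order $w$, a subset $T \subseteq X$ with $|T| = k$ and $a \in X$, the number of ways to write $a$ as a product in $T$ is the number of ordered pairs $(x,y)\in T\times T$ with $xy=a$. $T$ is a $(w,k,\lambda,\mu)$ partial sum set if every nonidentity element of $T$ is a product in $T$ in exactly $\lambda$ ways and every nonidentity element of $X\setminus T$ is a product in $T$ in exactly $\mu$ ways; if $\lambda=\mu$, $T$ is a $(w,k,\mu)$ sum set. $P^{(-1)} = \{p^{ -1}: p\in P\}$. For a normal subgroup $N$ of order $2$, a sum set $T$ is type 2 with respect to $N$ if $|T\cap N| = 1$ and $T$ meets each other coset of $N$ in $0$ or $2$ elements. -}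

module Defs where

open import Level using (Level; _⊔_) renaming (suc to lsuc)
open import Algebra.Bundles using (Group)
open import Algebra.Construct.DirectProduct using () renaming (group to directProduct)
open import Data.Bool using (Bool; true; false; _∧_; _∨_; not)
import Data.Bool as B
open import Data.Bool.Properties using (∧-identityʳ; ∧-zeroʳ)
open import Data.Nat using (ℕ; zero; suc; _+_)
open import Data.Integer using (ℤ; +_)
open import Data.List using (List; []; _∷_; _++_; map; length; cartesianProduct)
import Data.Nat.Properties
open import Data.Product using (_×_; _,_; proj₁; proj₂)
open import Data.Product.Relation.Binary.Pointwise.NonDependent using (×-decidable)
open import Data.Sum using (_⊎_)
open import Relation.Binary using (Decidable)
open import Relation.Nullary using (¬_; does)
open import Relation.Binary.PropositionalEquality using (_≡_; refl; cong; cong₂; sym; trans)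

countB : ∀ {a} {A : Set a} → (A → Bool) → List A → ℕ
countB p []       = 0
countB p (x ∷ xs) with p x
... | true  = suc (countB p xs)
... | false = countB p xs

record FiniteGroup (c ℓ : Level) : Set (lsuc (c ⊔ ℓ)) where
  field
    group : Group c ℓ
  open Group group public
  field
    _≟_   : Decidable _≈_
    elems : List Carrier
    enum  : ∀ x → countB (λ y → does (y ≟ x)) elems ≡ 1

  order : ℕ
  order = length elems

  Subset : Set c
  Subset = Carrier → Bool

  RespectsEq : Subset → Set (c ⊔ ℓ)
  RespectsEq T = ∀ {x y} → x ≈ y → T x ≡ T y

  size : Subset → ℕ
  size T = countB T elems

  ways : Subset → Carrier → ℕ
  ways T a = countB (λ (p : Carrier × Carrier) → T (proj₁ p) ∧ T (proj₂ p) ∧ does ((proj₁ p ∙ proj₂ p) ≟ a))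
                    (cartesianProduct elems elems)

  IsPartialSumSet : ℕ → ℕ → ℤ → ℤ → Subset → Set (c ⊔ ℓ)
  IsPartialSumSet w k lam mu T =
    order ≡ w × size T ≡ k ×
    (∀ a → ¬ (a ≈ ε) → (T a ≡ true → + ways T a ≡ lam) × (T a ≡ false → + ways T a ≡ mu))

  IsSumSet : ℕ → ℕ → ℤ → Subset → Set (c ⊔ ℓ)
  IsSumSet w k mu T = IsPartialSumSet w k mu mu T

  _∩_ : Subset → Subset → Subset
  (T ∩ U) x = T x ∧ U x

  _∪_ : Subset → Subset → Subset
  (T ∪ U) x = T x ∨ U x

  ⟨_⟩ : Carrier → Subset
  ⟨ g ⟩ x = does (x ≟ g)

  inverseSet : Subset → Subset
  inverseSet P x = P (x ⁻¹)

  -- T is type 2 with respect to N (N a normal subgroup of order 2):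
  -- |T ∩ N| = 1 and T meets every coset xN ≠ N in 0 or 2 elements.
  -- y ∈ xN  iff  x⁻¹ ∙ y ∈ N; the cosets other than N are the xN with x ∉ N.
  IsType2 : Subset → Subset → Set c
  IsType2 N T =
    size (T ∩ N) ≡ 1 ×
    (∀ x → N x ≡ false → size (λ y → T y ∧ N (x ⁻¹ ∙ y)) ≡ 0 ⊎ size (λ y → T y ∧ N (x ⁻¹ ∙ y)) ≡ 2)

-- The cyclic group {1 , z} of order 2, realised on Bool with xor
-- (false = 1, true = z).

private
  xor-assoc : ∀ x y z → (x B.xor y) B.xor z ≡ x B.xor (y B.xor z)
  xor-assoc false y z = refl
  xor-assoc true false z = refl
  xor-assoc true true false = refl
  xor-assoc true true true = refl

  xor-idʳ : ∀ x → x B.xor false ≡ x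
  xor-idʳ false = refl
  xor-idʳ true = refl

  xor-self : ∀ x → x B.xor x ≡ false
  xor-self false = refl
  xor-self true = refl

C₂ : Group _ _
C₂ = record
  { Carrier = Bool ; _≈_ = _≡_ ; _∙_ = B._xor_ ; ε = false ; _⁻¹ = λ x → x
  ; isGroup = record
    { isMonoid = record
      { isSemigroup = record
        { isMagma = record
          { isEquivalence = record { refl = refl ; sym = sym ; trans = trans }
          ; ∙-cong = cong₂ B._xor_ }
        ; assoc = xor-assoc }
      ; identity = (λ x → refl) , xor-idʳ }
    ; inverse = xor-self , xor-self
    ; ⁻¹-cong = λ p → p }
  }

private
  countB-++ : ∀ {a} {A : Set a} (p : A → Bool) xs ys →
              countB p (xs ++ ys) ≡ countB p xs + countB p ys
  countB-++ p [] ys = refl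
  countB-++ p (x ∷ xs) ys with p x
  ... | true  = cong suc (countB-++ p xs ys)
  ... | false = countB-++ p xs ys

  countB-map : ∀ {a b} {A : Set a} {C : Set b} (p : C → Bool) (f : A → C) xs →
               countB p (map f xs) ≡ countB (λ x → p (f x)) xs
  countB-map p f [] = refl
  countB-map p f (x ∷ xs) with p (f x)
  ... | true  = cong suc (countB-map p f xs)
  ... | false = countB-map p f xs

  countB-ext : ∀ {a} {A : Set a} (p q : A → Bool) → (∀ x → p x ≡ q x) → ∀ xs →
               countB p xs ≡ countB q xs
  countB-ext p q e [] = refl
  countB-ext p q e (x ∷ xs) with p x | q x | e x
  ... | true  | .true  | refl = cong suc (countB-ext p q e xs)
  ... | false | .false | refl = countB-ext p q e xs

  countB-none : ∀ {a} {A : Set a} (xs : List A) → countB (λ _ → false) xs ≡ 0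
  countB-none [] = refl
  countB-none (x ∷ xs) = countB-none xs

_×C₂ : ∀ {c ℓ} → FiniteGroup c ℓ → FiniteGroup c ℓ
_×C₂ {c} {ℓ} K = record
  { group = directProduct K.group C₂
  ; _≟_   = ×-decidable K._≟_ B._≟_
  ; elems = map (λ k → k , false) K.elems ++ map (λ k → k , true) K.elems
  ; enum  = enumG
  }
  where
    module K = FiniteGroup K
    enumG : ∀ x → countB (λ y → does (×-decidable K._≟_ B._≟_ y x))
                         (map (λ k → k , false) K.elems ++ map (λ k → k , true) K.elems) ≡ 1
    enumG (x , b) =
      trans (countB-++ _ (map (λ k → k , false) K.elems) (map (λ k → k , true) K.elems))
            (trans (cong₂ _+_ (countB-map _ (λ k → k , false) K.elems)
                              (countB-map _ (λ k → k , true) K.elems))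
                   (go b))
      where
        go : ∀ b → countB (λ k → does (×-decidable K._≟_ B._≟_ (k , false) (x , b))) K.elems
                 + countB (λ k → does (×-decidable K._≟_ B._≟_ (k , true) (x , b))) K.elems ≡ 1
        go false = trans (cong₂ _+_ (countB-ext _ _ (λ k → ∧-identityʳ (does (k K.≟ x))) K.elems)
                                    (trans (countB-ext _ _ (λ k → ∧-zeroʳ (does (k K.≟ x))) K.elems)
                                           (countB-none K.elems)))
                         (trans (Data.Nat.Properties.+-identityʳ _) (K.enum x))
        go true  = trans (cong₂ _+_ (trans (countB-ext _ _ (λ k → ∧-zeroʳ (does (k K.≟ x))) K.elems)
                                           (countB-none K.elems))
                                    (countB-ext _ _ (λ k → ∧-identityʳ (does (k K.≟ x))) K.elems))
                         (K.enum x)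

module Submission where

-- S = P ∪ Pz is P × {1, z}, so each (a, b) ∈ G is a product in S in exactly twice as many
-- ways as a is a product in P.  Hence S has the doubled parameters (2β - 2, 2β) at every
-- (a, b) with a ≠ 1, and the only other nonidentity element, z ∉ S, is a product in S in
-- 2 |{x ∈ P : x⁻¹ ∈ P}| ways: this is 2β exactly when |P ∩ P⁻¹| = β.
--
-- Adjoining to S an involution c ∉ S whose translates leave S invariant (c = 1 or z) adds
-- [a c⁻¹ ∈ S] + [c⁻¹ a ∈ S] + [c c = a] = 2 [a ∈ S] representations of each a ≠ 1, which turns
-- a (w, k, μ - 2, μ) partial sum set into a (w, k + 1, μ) sum set.  It is of type 2 because
-- S ∪ {c} meets {1, z} only in c and is a union of cosets of {1, z} elsewhere.

open import Defs

module Counting where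

  open import Data.Bool using (Bool; true; false; _∧_; _∨_)
  open import Data.List using (List; []; _∷_; _++_; map; cartesianProduct)
  open import Data.Nat using (ℕ; suc; _+_; _*_)
  open import Data.Nat.Properties using (+-assoc; +-identityʳ; *-zeroʳ; *-distribˡ-+; +-commutativeSemigroup)
  open import Data.Product using (_,_)
  open import Relation.Binary.PropositionalEquality using (_≡_; refl; sym; trans; cong; cong₂)
  open import Algebra.Properties.CommutativeSemigroup +-commutativeSemigroup using (interchange)

  [_] : Bool → ℕ
  [ true ]  = 1
  [ false ] = 0

  [∧] : ∀ a b → [ a ∧ b ] ≡ [ a ] * [ b ]
  [∧] true  b = sym (+-identityʳ [ b ])
  [∧] false b = refl

  [∨]-disjoint : ∀ a b → a ∧ b ≡ false → [ a ∨ b ] ≡ [ a ] + [ b ]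
  [∨]-disjoint true  false _ = refl
  [∨]-disjoint false b     _ = refl

  module _ {a} {A : Set a} where

    ∑ : List A → (A → ℕ) → ℕ
    ∑ []       f = 0
    ∑ (x ∷ xs) f = f x + ∑ xs f

    infix 5 ∑
    syntax ∑ xs (λ x → e) = ∑[ x ∈ xs ] e

    countB-∑ : ∀ p xs → countB p xs ≡ ∑[ x ∈ xs ] [ p x ]
    countB-∑ p []       = refl
    countB-∑ p (x ∷ xs) with p x
    ... | true  = cong suc (countB-∑ p xs)
    ... | false = countB-∑ p xs

    ∑-cong : ∀ {f g : A → ℕ} → (∀ x → f x ≡ g x) → ∀ xs → ∑ xs f ≡ ∑ xs g
    ∑-cong f≗g []       = refl
    ∑-cong f≗g (x ∷ xs) = cong₂ _+_ (f≗g x) (∑-cong f≗g xs)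

    countB-cong : ∀ {p q : A → Bool} → (∀ x → p x ≡ q x) → ∀ xs → countB p xs ≡ countB q xs
    countB-cong {p} {q} p≗q xs =
      trans (countB-∑ p xs) (trans (∑-cong (λ x → cong [_] (p≗q x)) xs) (sym (countB-∑ q xs)))

    ∑-++ : ∀ f xs ys → ∑ (xs ++ ys) f ≡ ∑ xs f + ∑ ys f
    ∑-++ f []       ys = refl
    ∑-++ f (x ∷ xs) ys = trans (cong (λ s → f x + s) (∑-++ f xs ys)) (sym (+-assoc (f x) _ _))

    ∑-+ : ∀ f g xs → ∑[ x ∈ xs ] (f x + g x) ≡ ∑ xs f + ∑ xs g
    ∑-+ f g []       = refl
    ∑-+ f g (x ∷ xs) = trans (cong (λ s → f x + g x + s) (∑-+ f g xs)) (interchange (f x) (g x) _ _)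

    ∑-*ˡ : ∀ n f xs → ∑[ x ∈ xs ] (n * f x) ≡ n * ∑ xs f
    ∑-*ˡ n f []       = sym (*-zeroʳ n)
    ∑-*ˡ n f (x ∷ xs) = trans (cong (λ s → n * f x + s) (∑-*ˡ n f xs)) (sym (*-distribˡ-+ n (f x) _))

  ∑-map : ∀ {a b} {A : Set a} {B : Set b} (g : A → B) f xs → ∑ (map g xs) f ≡ ∑[ x ∈ xs ] f (g x)
  ∑-map g f []       = refl
  ∑-map g f (x ∷ xs) = cong (λ s → f (g x) + s) (∑-map g f xs)

  ∑-cartesianProduct : ∀ {a b} {A : Set a} {B : Set b} f (xs : List A) (ys : List B) →
                       ∑ (cartesianProduct xs ys) f ≡ ∑[ x ∈ xs ] ∑[ y ∈ ys ] f (x , y)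
  ∑-cartesianProduct f []       ys = refl
  ∑-cartesianProduct f (x ∷ xs) ys =
    trans (∑-++ f (map (x ,_) ys) _) (cong₂ _+_ (∑-map (x ,_) f ys) (∑-cartesianProduct f xs ys))

module FiniteGroupProperties {c ℓ} (H : FiniteGroup c ℓ) where

  open import Data.Bool using (true; false; _∧_; _∨_)
  open import Data.Bool.Properties using (∧-identityʳ; ∧-zeroʳ)
  open import Data.Integer as ℤ using (+_)
  import Data.Integer.Properties as ℤ
  open import Data.List using (cartesianProduct)
  open import Data.Nat using (ℕ; _+_; _*_)
  open import Data.Nat.Properties using (*-comm; *-identityʳ; +-identityʳ; +-assoc; *-distribˡ-+; *-distribʳ-+)
  open import Data.Product using (_,_; proj₁; proj₂)
  import Data.Sum as Sum
  open import Function.Bundles using (_⇔_; mk⇔; module Equivalence)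
  open import Relation.Binary.Core using (_Preserves_⟶_)
  open import Relation.Binary.PropositionalEquality hiding ([_])
  open import Relation.Nullary using (¬_; does; yes; no)
  open import Relation.Nullary.Decidable using (does-⇔; dec-false)

  open FiniteGroup H renaming (refl to ≈-refl; sym to ≈-sym; trans to ≈-trans)
  open import Algebra.Properties.Group group
    using (\\-leftDividesˡ; //-rightDividesˡ; x≈z//y; y≈x\\z; inverseʳ-unique; ⁻¹-involutive)
  open Counting

  does-≟-⇔ : ∀ {x g y h} → (x ≈ g ⇔ y ≈ h) → does (x ≟ g) ≡ does (y ≟ h)
  does-≟-⇔ x≈g⇔y≈h = does-⇔ x≈g⇔y≈h (_ ≟ _) (_ ≟ _)

  ≟-respˡ : ∀ {x y} g → x ≈ y → does (x ≟ g) ≡ does (y ≟ g)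
  ≟-respˡ g x≈y = does-≟-⇔ (mk⇔ (≈-trans (≈-sym x≈y)) (≈-trans x≈y))

  ∙≈⇔≈\\ : ∀ x y z → x ∙ y ≈ z ⇔ y ≈ x \\ z
  ∙≈⇔≈\\ x y z = mk⇔ (y≈x\\z x y z) (λ y≈x\\z → ≈-trans (∙-congˡ y≈x\\z) (\\-leftDividesˡ x z))

  ∙≈⇔≈// : ∀ x y z → x ∙ y ≈ z ⇔ x ≈ z // y
  ∙≈⇔≈// x y z = mk⇔ (x≈z//y x y z) (λ x≈z//y → ≈-trans (∙-congʳ x≈z//y) (//-rightDividesˡ y z))

  \\≈⇔≈// : ∀ x y z → x \\ y ≈ z ⇔ x ≈ y // z
  \\≈⇔≈// x y z = mk⇔
    (λ x\\y≈z → to (∙≈⇔≈// x z y) (from (∙≈⇔≈\\ x z y) (≈-sym x\\y≈z)))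
    (λ x≈y//z → ≈-sym (to (∙≈⇔≈\\ x z y) (from (∙≈⇔≈// x z y) x≈y//z)))
    where open Equivalence

  \\≈ε⇔≈ : ∀ x y → x \\ y ≈ ε ⇔ y ≈ x
  \\≈ε⇔≈ x y = mk⇔
    (λ x\\y≈ε → ≈-trans (inverseʳ-unique (x ⁻¹) y x\\y≈ε) (⁻¹-involutive x))
    (λ y≈x → ≈-trans (∙-congˡ y≈x) (inverseˡ x))

  ∑-≟ : ∀ a → ∑[ x ∈ elems ] [ does (x ≟ a) ] ≡ 1
  ∑-≟ a = trans (sym (countB-∑ _ elems)) (enum a)

  ∑-select : ∀ (f : Carrier → ℕ) → f Preserves _≈_ ⟶ _≡_ → ∀ a →
             ∑[ x ∈ elems ] ([ does (x ≟ a) ] * f x) ≡ f a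
  ∑-select f f-resp a = begin
    ∑[ x ∈ elems ] ([ does (x ≟ a) ] * f x) ≡⟨ ∑-cong selected elems ⟩
    ∑[ x ∈ elems ] (f a * [ does (x ≟ a) ]) ≡⟨ ∑-*ˡ (f a) _ elems ⟩
    f a * (∑[ x ∈ elems ] [ does (x ≟ a) ]) ≡⟨ cong (f a *_) (∑-≟ a) ⟩
    f a * 1                                  ≡⟨ *-identityʳ (f a) ⟩
    f a                                      ∎
    where
    open ≡-Reasoning
    selected : ∀ x → [ does (x ≟ a) ] * f x ≡ f a * [ does (x ≟ a) ]
    selected x with x ≟ a
    ... | yes x≈a = trans (+-identityʳ (f x)) (trans (f-resp x≈a) (sym (*-identityʳ (f a))))
    ... | no _    = sym (*-comm (f a) 0)

  []-resp : ∀ {T} → RespectsEq T → (λ x → [ T x ]) Preserves _≈_ ⟶ _≡_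
  []-resp T-resp x≈y = cong [_] (T-resp x≈y)

  ways-∑ : ∀ T → RespectsEq T → ∀ a → ways T a ≡ ∑[ x ∈ elems ] [ T x ∧ T (x \\ a) ]
  ways-∑ T T-resp a = begin
    ways T a
      ≡⟨ countB-∑ _ (cartesianProduct elems elems) ⟩
    ∑[ p ∈ cartesianProduct elems elems ] _
      ≡⟨ ∑-cartesianProduct _ elems elems ⟩
    ∑[ x ∈ elems ] ∑[ y ∈ elems ] [ T x ∧ T y ∧ does ((x ∙ y) ≟ a) ]
      ≡⟨ ∑-cong row elems ⟩
    ∑[ x ∈ elems ] [ T x ∧ T (x \\ a) ] ∎
    where
    open ≡-Reasoning
    cell : ∀ x y → [ T x ∧ T y ∧ does ((x ∙ y) ≟ a) ] ≡ [ T x ] * ([ does (y ≟ (x \\ a)) ] * [ T y ])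
    cell x y = begin
      [ T x ∧ T y ∧ does ((x ∙ y) ≟ a) ]
        ≡⟨ trans ([∧] (T x) _) (cong ([ T x ] *_) ([∧] (T y) _)) ⟩
      [ T x ] * ([ T y ] * [ does ((x ∙ y) ≟ a) ])
        ≡⟨ cong ([ T x ] *_) (*-comm [ T y ] _) ⟩
      [ T x ] * ([ does ((x ∙ y) ≟ a) ] * [ T y ])
        ≡⟨ cong (λ d → [ T x ] * ([ d ] * [ T y ])) (does-≟-⇔ (∙≈⇔≈\\ x y a)) ⟩
      [ T x ] * ([ does (y ≟ (x \\ a)) ] * [ T y ]) ∎
    row : ∀ x → ∑[ y ∈ elems ] [ T x ∧ T y ∧ does ((x ∙ y) ≟ a) ] ≡ [ T x ∧ T (x \\ a) ]
    row x = begin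
      ∑[ y ∈ elems ] [ T x ∧ T y ∧ does ((x ∙ y) ≟ a) ]
        ≡⟨ ∑-cong (cell x) elems ⟩
      ∑[ y ∈ elems ] ([ T x ] * ([ does (y ≟ (x \\ a)) ] * [ T y ]))
        ≡⟨ ∑-*ˡ [ T x ] _ elems ⟩
      [ T x ] * (∑[ y ∈ elems ] ([ does (y ≟ (x \\ a)) ] * [ T y ]))
        ≡⟨ cong ([ T x ] *_) (∑-select _ ([]-resp T-resp) (x \\ a)) ⟩
      [ T x ] * [ T (x \\ a) ]
        ≡⟨ [∧] (T x) _ ⟨
      [ T x ∧ T (x \\ a) ] ∎

  ways-≈ε : ∀ T → RespectsEq T → ∀ {a} → a ≈ ε → ways T a ≡ size (T ∩ inverseSet T)
  ways-≈ε T T-resp {a} a≈ε = begin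
    ways T a
      ≡⟨ ways-∑ T T-resp a ⟩
    ∑[ x ∈ elems ] [ T x ∧ T (x \\ a) ]
      ≡⟨ ∑-cong (λ x → cong (λ t → [ T x ∧ t ]) (T-resp (x\\a≈x⁻¹ x))) elems ⟩
    ∑[ x ∈ elems ] [ T x ∧ T (x ⁻¹) ]
      ≡⟨ countB-∑ _ elems ⟨
    size (T ∩ inverseSet T) ∎
    where
    open ≡-Reasoning
    x\\a≈x⁻¹ : ∀ x → x \\ a ≈ x ⁻¹
    x\\a≈x⁻¹ x = ≈-trans (∙-congˡ a≈ε) (identityʳ (x ⁻¹))

  ∪-singleton-disjoint : ∀ S → RespectsEq S → ∀ {c} → S c ≡ false →
                         ∀ x → S x ∧ does (x ≟ c) ≡ false
  ∪-singleton-disjoint S S-resp {c} c∉S x with x ≟ c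
  ... | yes x≈c = trans (∧-identityʳ (S x)) (trans (S-resp x≈c) c∉S)
  ... | no _    = ∧-zeroʳ (S x)

  ∪-singleton-resp : ∀ S → RespectsEq S → ∀ c → RespectsEq (S ∪ ⟨ c ⟩)
  ∪-singleton-resp S S-resp c x≈y = cong₂ _∨_ (S-resp x≈y) (≟-respˡ c x≈y)

  size-∪-singleton : ∀ S → RespectsEq S → ∀ {c} → S c ≡ false → size (S ∪ ⟨ c ⟩) ≡ size S + 1
  size-∪-singleton S S-resp {c} c∉S = begin
    size (S ∪ ⟨ c ⟩)
      ≡⟨ countB-∑ _ elems ⟩
    ∑[ x ∈ elems ] [ S x ∨ does (x ≟ c) ]
      ≡⟨ ∑-cong (λ x → [∨]-disjoint (S x) _ (∪-singleton-disjoint S S-resp c∉S x)) elems ⟩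
    ∑[ x ∈ elems ] ([ S x ] + [ does (x ≟ c) ])
      ≡⟨ ∑-+ _ _ elems ⟩
    (∑[ x ∈ elems ] [ S x ]) + (∑[ x ∈ elems ] [ does (x ≟ c) ])
      ≡⟨ cong₂ _+_ (countB-∑ S elems) (sym (∑-≟ c)) ⟨
    size S + 1 ∎
    where open ≡-Reasoning

  ways-∪-singleton : ∀ S → RespectsEq S → ∀ {c} → S c ≡ false → ∀ a →
    ways (S ∪ ⟨ c ⟩) a ≡ ways S a + ([ S (a // c) ] + ([ S (c \\ a) ] + [ does ((c \\ a) ≟ c) ]))
  ways-∪-singleton S S-resp {c} c∉S a = begin
    ways (S ∪ ⟨ c ⟩) a
      ≡⟨ ways-∑ (S ∪ ⟨ c ⟩) (∪-singleton-resp S S-resp c) a ⟩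
    ∑[ x ∈ elems ] [ (S ∪ ⟨ c ⟩) x ∧ (S ∪ ⟨ c ⟩) (x \\ a) ]
      ≡⟨ ∑-cong expand elems ⟩
    ∑[ x ∈ elems ] ((A x + B x) + (C x + D x))
      ≡⟨ trans (∑-+ _ _ elems) (cong₂ _+_ (∑-+ A B elems) (∑-+ C D elems)) ⟩
    (∑ elems A + ∑ elems B) + (∑ elems C + ∑ elems D)
      ≡⟨ cong₂ _+_ (cong₂ _+_ (sym (ways-∑ S S-resp a)) ∑B) (cong₂ _+_ ∑C ∑D) ⟩
    (ways S a + [ S (a // c) ]) + ([ S (c \\ a) ] + [ does ((c \\ a) ≟ c) ])
      ≡⟨ +-assoc (ways S a) _ _ ⟩
    ways S a + ([ S (a // c) ] + ([ S (c \\ a) ] + [ does ((c \\ a) ≟ c) ])) ∎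
    where
    open ≡-Reasoning
    A B C D : Carrier → ℕ
    A x = [ S x ∧ S (x \\ a) ]
    B x = [ S x ] * [ does ((x \\ a) ≟ c) ]
    C x = [ does (x ≟ c) ] * [ S (x \\ a) ]
    D x = [ does (x ≟ c) ] * [ does ((x \\ a) ≟ c) ]

    [∪] : ∀ x → [ (S ∪ ⟨ c ⟩) x ] ≡ [ S x ] + [ does (x ≟ c) ]
    [∪] x = [∨]-disjoint (S x) _ (∪-singleton-disjoint S S-resp c∉S x)

    expand : ∀ x → [ (S ∪ ⟨ c ⟩) x ∧ (S ∪ ⟨ c ⟩) (x \\ a) ] ≡ (A x + B x) + (C x + D x)
    expand x = begin
      [ (S ∪ ⟨ c ⟩) x ∧ (S ∪ ⟨ c ⟩) (x \\ a) ]
        ≡⟨ trans ([∧] ((S ∪ ⟨ c ⟩) x) _) (cong₂ _*_ ([∪] x) ([∪] (x \\ a))) ⟩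
      ([ S x ] + [ does (x ≟ c) ]) * ([ S (x \\ a) ] + [ does ((x \\ a) ≟ c) ])
        ≡⟨ *-distribʳ-+ _ [ S x ] _ ⟩
      [ S x ] * ([ S (x \\ a) ] + [ does ((x \\ a) ≟ c) ])
        + [ does (x ≟ c) ] * ([ S (x \\ a) ] + [ does ((x \\ a) ≟ c) ])
        ≡⟨ cong₂ _+_ (*-distribˡ-+ [ S x ] _ _) (*-distribˡ-+ [ does (x ≟ c) ] _ _) ⟩
      ([ S x ] * [ S (x \\ a) ] + B x) + (C x + D x)
        ≡⟨ cong (λ t → (t + B x) + (C x + D x)) ([∧] (S x) _) ⟨
      (A x + B x) + (C x + D x) ∎

    \\a-resp : ∀ {x y} → x ≈ y → x \\ a ≈ y \\ a
    \\a-resp x≈y = ∙-congʳ (⁻¹-cong x≈y)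

    ∑B : ∑ elems B ≡ [ S (a // c) ]
    ∑B = trans (∑-cong swap elems) (∑-select _ ([]-resp S-resp) (a // c))
      where
      swap : ∀ x → B x ≡ [ does (x ≟ (a // c)) ] * [ S x ]
      swap x = trans (*-comm [ S x ] _) (cong (λ d → [ d ] * [ S x ]) (does-≟-⇔ (\\≈⇔≈// x a c)))

    ∑C : ∑ elems C ≡ [ S (c \\ a) ]
    ∑C = ∑-select _ (λ x≈y → cong [_] (S-resp (\\a-resp x≈y))) c

    ∑D : ∑ elems D ≡ [ does ((c \\ a) ≟ c) ]
    ∑D = ∑-select _ (λ x≈y → cong [_] (≟-respˡ c (\\a-resp x≈y))) c

  ∪-singleton-isSumSet : ∀ S → RespectsEq S → ∀ {c} → S c ≡ false → c ∙ c ≈ ε →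
    (∀ g → S (g // c) ≡ S g) → (∀ g → S (c \\ g) ≡ S g) →
    ∀ {w k μ} → IsPartialSumSet w k (μ ℤ.- + 2) μ S → IsSumSet w (k + 1) μ (S ∪ ⟨ c ⟩)
  ∪-singleton-isSumSet S S-resp {c} c∉S c∙c≈ε S-//c S-c\\ {μ = μ} (order≡w , size≡k , counts) =
    order≡w , trans (size-∪-singleton S S-resp c∉S) (cong (_+ 1) size≡k) ,
    λ a a≉ε → (λ _ → ways≡μ a a≉ε) , (λ _ → ways≡μ a a≉ε)
    where
    c\\a≉c : ∀ a → ¬ a ≈ ε → does ((c \\ a) ≟ c) ≡ false
    c\\a≉c a a≉ε = dec-false ((c \\ a) ≟ c)
      (λ c\\a≈c → a≉ε (≈-trans (≈-sym (Equivalence.from (∙≈⇔≈\\ c c a) (≈-sym c\\a≈c))) c∙c≈ε))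

    ways-∪ : ∀ a → ¬ a ≈ ε → ways (S ∪ ⟨ c ⟩) a ≡ ways S a + 2 * [ S a ]
    ways-∪ a a≉ε = begin
      ways (S ∪ ⟨ c ⟩) a
        ≡⟨ ways-∪-singleton S S-resp c∉S a ⟩
      ways S a + ([ S (a // c) ] + ([ S (c \\ a) ] + [ does ((c \\ a) ≟ c) ]))
        ≡⟨ cong₂ (λ s t → ways S a + ([ s ] + ([ t ] + [ does ((c \\ a) ≟ c) ]))) (S-//c a) (S-c\\ a) ⟩
      ways S a + ([ S a ] + ([ S a ] + [ does ((c \\ a) ≟ c) ]))
        ≡⟨ cong (λ d → ways S a + ([ S a ] + ([ S a ] + [ d ]))) (c\\a≉c a a≉ε) ⟩
      ways S a + 2 * [ S a ] ∎
      where open ≡-Reasoning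

    ways≡μ : ∀ a → ¬ a ≈ ε → + ways (S ∪ ⟨ c ⟩) a ≡ μ
    ways≡μ a a≉ε = trans (cong +_ (ways-∪ a a≉ε)) (shift (S a) refl)
      where
      shift : ∀ s → S a ≡ s → + (ways S a + 2 * [ s ]) ≡ μ
      shift true  Sa = begin
        + (ways S a + 2)          ≡⟨ ℤ.pos-+ (ways S a) 2 ⟩
        + ways S a ℤ.+ + 2        ≡⟨ cong (ℤ._+ + 2) (proj₁ (counts a a≉ε) Sa) ⟩
        (μ ℤ.- + 2) ℤ.+ + 2       ≡⟨ ℤ.+-assoc μ (ℤ.- + 2) (+ 2) ⟩
        μ ℤ.+ + 0                 ≡⟨ ℤ.+-identityʳ μ ⟩
        μ                         ∎
        where open ≡-Reasoning
      shift false Sa = trans (cong +_ (+-identityʳ (ways S a))) (proj₂ (counts a a≉ε) Sa)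

  size-cong : ∀ {T U} → (∀ x → T x ≡ U x) → size T ≡ size U
  size-cong T≗U = countB-cong T≗U elems

  ways-cong : ∀ {T U} → (∀ x → T x ≡ U x) → ∀ a → ways T a ≡ ways U a
  ways-cong T≗U a =
    countB-cong (λ (x , y) → cong₂ (λ s t → s ∧ t ∧ does ((x ∙ y) ≟ a)) (T≗U x) (T≗U y))
                (cartesianProduct elems elems)

  isPartialSumSet-cong : ∀ {T U w k lam mu} → (∀ x → T x ≡ U x) →
                         IsPartialSumSet w k lam mu T → IsPartialSumSet w k lam mu U
  isPartialSumSet-cong {T} {U} T≗U (order≡w , size≡k , counts) =
    order≡w , trans (sym (size-cong T≗U)) size≡k ,
    λ a a≉ε → (λ Ua → transport a (proj₁ (counts a a≉ε) (trans (T≗U a) Ua)))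
            , (λ Ua → transport a (proj₂ (counts a a≉ε) (trans (T≗U a) Ua)))
    where
    transport : ∀ a {n} → + ways T a ≡ n → + ways U a ≡ n
    transport a = trans (cong +_ (sym (ways-cong T≗U a)))

  isType2-cong : ∀ {N T U} → (∀ x → T x ≡ U x) → IsType2 N T → IsType2 N U
  isType2-cong {N} {T} {U} T≗U (meets-N , meets-cosets) =
    trans (sym (∩-size N)) meets-N ,
    λ x Nx → Sum.map (trans (sym (∩-size _))) (trans (sym (∩-size _))) (meets-cosets x Nx)
    where
    ∩-size : ∀ V → size (λ y → T y ∧ V y) ≡ size (λ y → U y ∧ V y)
    ∩-size V = size-cong (λ y → cong (_∧ V y) (T≗U y))

module DirectProductC₂ {c ℓ} (K : FiniteGroup c ℓ) where

  open import Data.Bool using (true; false; not; _∧_)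
  import Data.Bool as B
  open import Data.Bool.Properties using (xor-same)
  open import Data.Integer as ℤ using (+_)
  import Data.Integer.Properties as ℤ
  open import Data.List using (map; length)
  open import Data.List.Properties using (length-++; length-map)
  open import Data.Nat using (_+_; _*_)
  open import Data.Nat.Properties using (+-identityʳ; *-comm; *-distribˡ-+)
  open import Data.Product using (_×_; _,_; proj₁; proj₂)
  open import Data.Sum using (_⊎_; inj₁; inj₂)
  open import Function.Base using (case_of_)
  open import Relation.Binary.PropositionalEquality hiding ([_])
  open import Relation.Nullary using (¬_; does; yes; no)
  open import Relation.Nullary.Decidable using (dec-true; dec-false)

  open Counting
  private
    module K = FiniteGroup K
    module G = FiniteGroup (K ×C₂)
    module KP = FiniteGroupProperties K
    module GP = FiniteGroupProperties (K ×C₂)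
  open import Algebra.Properties.Group K.group using (ε⁻¹≈ε)

  z : G.Carrier
  z = K.ε , true

  N : G.Subset
  N = G.⟨ G.ε ⟩ G.∪ G.⟨ z ⟩

  lift : K.Subset → G.Subset
  lift P g = P (proj₁ g)

  P∪Pz : K.Subset → G.Subset
  P∪Pz P = (λ g → P (proj₁ g) ∧ not (proj₂ g)) G.∪ (λ g → P (proj₁ g) ∧ proj₂ g)

  P∪Pz≗lift : ∀ P g → P∪Pz P g ≡ lift P g
  P∪Pz≗lift P (a , b) with P a | b
  ... | true  | true  = refl
  ... | true  | false = refl
  ... | false | true  = refl
  ... | false | false = refl

  lift-resp : ∀ {P} → K.RespectsEq P → G.RespectsEq (lift P)
  lift-resp P-resp (a≈a′ , _) = P-resp a≈a′

  order-×C₂ : G.order ≡ 2 * K.order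
  order-×C₂ = begin
    G.order
      ≡⟨ length-++ (map (_, false) K.elems) ⟩
    length (map (_, false) K.elems) + length (map (_, true) K.elems)
      ≡⟨ cong₂ _+_ (length-map _ K.elems) (length-map _ K.elems) ⟩
    K.order + K.order
      ≡⟨ cong (λ n → K.order + n) (+-identityʳ K.order) ⟨
    2 * K.order ∎
    where open ≡-Reasoning

  ∑-elems : ∀ f → ∑ G.elems f ≡ ∑[ k ∈ K.elems ] (f (k , false) + f (k , true))
  ∑-elems f = begin
    ∑ G.elems f
      ≡⟨ ∑-++ f (map (_, false) K.elems) _ ⟩
    ∑ (map (_, false) K.elems) f + ∑ (map (_, true) K.elems) f
      ≡⟨ cong₂ _+_ (∑-map _ f K.elems) (∑-map _ f K.elems) ⟩
    (∑[ k ∈ K.elems ] f (k , false)) + (∑[ k ∈ K.elems ] f (k , true))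
      ≡⟨ ∑-+ _ _ K.elems ⟨
    ∑[ k ∈ K.elems ] (f (k , false) + f (k , true)) ∎
    where open ≡-Reasoning

  ∑-elems-proj₁ : ∀ f → ∑[ g ∈ G.elems ] f (proj₁ g) ≡ 2 * ∑ K.elems f
  ∑-elems-proj₁ f = trans (∑-elems (λ g → f (proj₁ g)))
    (trans (∑-+ f f K.elems) (cong (λ n → ∑ K.elems f + n) (sym (+-identityʳ (∑ K.elems f)))))

  size-lift : ∀ P → G.size (lift P) ≡ 2 * K.size P
  size-lift P = begin
    G.size (lift P)                       ≡⟨ countB-∑ (lift P) G.elems ⟩
    ∑[ g ∈ G.elems ] [ P (proj₁ g) ]      ≡⟨ ∑-elems-proj₁ (λ k → [ P k ]) ⟩
    2 * (∑[ k ∈ K.elems ] [ P k ])        ≡⟨ cong (2 *_) (countB-∑ P K.elems) ⟨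
    2 * K.size P                          ∎
    where open ≡-Reasoning

  ways-lift : ∀ {P} → K.RespectsEq P → ∀ a b → G.ways (lift P) (a , b) ≡ 2 * K.ways P a
  ways-lift {P} P-resp a b = begin
    G.ways (lift P) (a , b)
      ≡⟨ GP.ways-∑ (lift P) (lift-resp P-resp) (a , b) ⟩
    ∑[ g ∈ G.elems ] [ P (proj₁ g) ∧ P (proj₁ g K.\\ a) ]
      ≡⟨ ∑-elems-proj₁ (λ k → [ P k ∧ P (k K.\\ a) ]) ⟩
    2 * (∑[ k ∈ K.elems ] [ P k ∧ P (k K.\\ a) ])
      ≡⟨ cong (2 *_) (KP.ways-∑ P P-resp a) ⟨
    2 * K.ways P a ∎
    where open ≡-Reasoning

  isPartialSumSet-lift : ∀ {P v k lam mu} → K.RespectsEq P → P K.ε ≡ false →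
    K.IsPartialSumSet v k lam mu P → + K.size (P K.∩ K.inverseSet P) ≡ mu →
    G.IsPartialSumSet (2 * v) (2 * k) (+ 2 ℤ.* lam) (+ 2 ℤ.* mu) (lift P)
  isPartialSumSet-lift {P} {lam = lam} {mu} P-resp ε∉P (order≡v , size≡k , counts) ∣P∩P⁻¹∣≡mu =
    trans order-×C₂ (cong (2 *_) order≡v) , trans (size-lift P) (cong (2 *_) size≡k) , doubled-counts
    where
    doubled : ∀ {a n} b → + K.ways P a ≡ n → + G.ways (lift P) (a , b) ≡ + 2 ℤ.* n
    doubled {a} b ways≡n =
      trans (cong +_ (ways-lift P-resp a b)) (trans (ℤ.pos-* 2 (K.ways P a)) (cong (+ 2 ℤ.*_) ways≡n))

    doubled-counts : ∀ g → ¬ g G.≈ G.ε →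
      (lift P g ≡ true → + G.ways (lift P) g ≡ + 2 ℤ.* lam) ×
      (lift P g ≡ false → + G.ways (lift P) g ≡ + 2 ℤ.* mu)
    doubled-counts (a , b) _ with a K.≟ K.ε
    ... | no a≉ε  = (λ Pa → doubled b (proj₁ (counts a a≉ε) Pa))
                  , (λ Pa → doubled b (proj₂ (counts a a≉ε) Pa))
    ... | yes a≈ε = (λ Pa → case trans (sym Pa) (trans (P-resp a≈ε) ε∉P) of λ ())
                  , (λ _ → doubled b (trans (cong +_ (KP.ways-≈ε P P-resp a≈ε)) ∣P∩P⁻¹∣≡mu))

  z≉ε : ¬ z G.≈ G.ε
  z≉ε (_ , ())

  lift-isPartialSumSet⇒size∩inverseSet : ∀ {P w k lam mu} → K.RespectsEq P → P K.ε ≡ false →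
    G.IsPartialSumSet w k lam (+ 2 ℤ.* mu) (lift P) → + K.size (P K.∩ K.inverseSet P) ≡ mu
  lift-isPartialSumSet⇒size∩inverseSet {P} {mu = mu} P-resp ε∉P (_ , _ , counts) =
    ℤ.*-cancelˡ-≡ (+ 2) _ mu (begin
      + 2 ℤ.* + K.size (P K.∩ K.inverseSet P) ≡⟨ ℤ.pos-* 2 (K.size (P K.∩ K.inverseSet P)) ⟨
      + (2 * K.size (P K.∩ K.inverseSet P))   ≡⟨ cong (λ n → + (2 * n)) (KP.ways-≈ε P P-resp K.refl) ⟨
      + (2 * K.ways P K.ε)                    ≡⟨ cong +_ (ways-lift P-resp K.ε true) ⟨
      + G.ways (lift P) z                     ≡⟨ proj₂ (counts z z≉ε) ε∉P ⟩
      + 2 ℤ.* mu                              ∎)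
    where open ≡-Reasoning

  lift-∪-isSumSet : ∀ {P w k μ} → K.RespectsEq P → P K.ε ≡ false → ∀ b →
    G.IsPartialSumSet w k (μ ℤ.- + 2) μ (lift P) → G.IsSumSet w (k + 1) μ (lift P G.∪ G.⟨ (K.ε , b) ⟩)
  lift-∪-isSumSet {P} P-resp ε∉P b =
    GP.∪-singleton-isSumSet (lift P) (lift-resp P-resp) ε∉P (K.identityˡ K.ε , xor-same b)
      (λ g → P-resp (K.trans (K.∙-congˡ ε⁻¹≈ε) (K.identityʳ (proj₁ g))))
      (λ g → P-resp (K.trans (K.∙-congʳ ε⁻¹≈ε) (K.identityˡ (proj₁ g))))

  N≗fibre : ∀ g → N g ≡ does (proj₁ g K.≟ K.ε)
  N≗fibre (a , b) with does (a K.≟ K.ε) | b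
  ... | true  | true  = refl
  ... | true  | false = refl
  ... | false | true  = refl
  ... | false | false = refl

  size-fibre : ∀ T → G.RespectsEq T → ∀ a →
    G.size (λ g → T g ∧ does (proj₁ g K.≟ a)) ≡ [ T (a , false) ] + [ T (a , true) ]
  size-fibre T T-resp a = begin
    G.size (λ g → T g ∧ does (proj₁ g K.≟ a))
      ≡⟨ trans (countB-∑ _ G.elems) (∑-elems _) ⟩
    ∑[ k ∈ K.elems ] ([ T (k , false) ∧ does (k K.≟ a) ] + [ T (k , true) ∧ does (k K.≟ a) ])
      ≡⟨ ∑-cong factor K.elems ⟩
    ∑[ k ∈ K.elems ] ([ does (k K.≟ a) ] * ([ T (k , false) ] + [ T (k , true) ]))
      ≡⟨ KP.∑-select _ (λ k≈k′ → cong₂ _+_ (cong [_] (T-resp (k≈k′ , refl)))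
                                            (cong [_] (T-resp (k≈k′ , refl)))) a ⟩
    [ T (a , false) ] + [ T (a , true) ] ∎
    where
    open ≡-Reasoning
    [∧≟a] : ∀ t k → [ t ∧ does (k K.≟ a) ] ≡ [ does (k K.≟ a) ] * [ t ]
    [∧≟a] t k = trans ([∧] t _) (*-comm [ t ] _)
    factor : ∀ k → [ T (k , false) ∧ does (k K.≟ a) ] + [ T (k , true) ∧ does (k K.≟ a) ]
                 ≡ [ does (k K.≟ a) ] * ([ T (k , false) ] + [ T (k , true) ])
    factor k = trans (cong₂ _+_ ([∧≟a] (T (k , false)) k) ([∧≟a] (T (k , true)) k))
                     (sym (*-distribˡ-+ [ does (k K.≟ a) ] _ _))

  isType2-×C₂ : ∀ T → G.RespectsEq T → [ T (K.ε , false) ] + [ T (K.ε , true) ] ≡ 1 →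
                (∀ a → ¬ a K.≈ K.ε → T (a , false) ≡ T (a , true)) → G.IsType2 N T
  isType2-×C₂ T T-resp meets-N uniform =
    trans (GP.size-cong (λ g → cong (T g ∧_) (N≗fibre g))) (trans (size-fibre T T-resp K.ε) meets-N) ,
    meets-cosets
    where
    zero-or-two : ∀ t {n} → n ≡ [ t ] + [ t ] → n ≡ 0 ⊎ n ≡ 2
    zero-or-two true  = inj₂
    zero-or-two false = inj₁

    meets-cosets : ∀ x → N x ≡ false →
      G.size (λ g → T g ∧ N (x G.⁻¹ G.∙ g)) ≡ 0 ⊎ G.size (λ g → T g ∧ N (x G.⁻¹ G.∙ g)) ≡ 2
    meets-cosets (a , b) Nx = zero-or-two (T (a , true))
      (trans coset-size (cong (λ t → [ t ] + [ T (a , true) ]) (uniform a a≉ε)))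
      where
      a≉ε : ¬ a K.≈ K.ε
      a≉ε a≈ε = case trans (sym (dec-true (a K.≟ K.ε) a≈ε)) (trans (sym (N≗fibre (a , b))) Nx) of λ ()
      coset-size : G.size (λ g → T g ∧ N ((a , b) G.⁻¹ G.∙ g)) ≡ [ T (a , false) ] + [ T (a , true) ]
      coset-size = trans (GP.size-cong (λ g → cong (T g ∧_) (N≗coset g))) (size-fibre T T-resp a)
        where
        N≗coset : ∀ g → N ((a , b) G.⁻¹ G.∙ g) ≡ does (proj₁ g K.≟ a)
        N≗coset g = trans (N≗fibre ((a , b) G.⁻¹ G.∙ g)) (KP.does-≟-⇔ (KP.\\≈ε⇔≈ a (proj₁ g)))

  lift-∪-isType2 : ∀ {P} → K.RespectsEq P → P K.ε ≡ false → ∀ b →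
                   G.IsType2 N (lift P G.∪ G.⟨ (K.ε , b) ⟩)
  lift-∪-isType2 {P} P-resp ε∉P b =
    isType2-×C₂ T (GP.∪-singleton-resp (lift P) (lift-resp P-resp) (K.ε , b)) meets-N uniform
    where
    T : G.Subset
    T = lift P G.∪ G.⟨ (K.ε , b) ⟩
    meets-N : [ T (K.ε , false) ] + [ T (K.ε , true) ] ≡ 1
    meets-N rewrite ε∉P | dec-true (K.ε K.≟ K.ε) K.refl = exactly-one b
      where
      exactly-one : ∀ b → [ does (false B.≟ b) ] + [ does (true B.≟ b) ] ≡ 1
      exactly-one false = refl
      exactly-one true  = refl
    uniform : ∀ a → ¬ a K.≈ K.ε → T (a , false) ≡ T (a , true)
    uniform a a≉ε rewrite dec-false (a K.≟ K.ε) a≉ε = refl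

open import Data.Bool using (true; false; not; _∧_; _∨_)
open import Data.Nat using (ℕ)
import Data.Nat as ℕ
open import Data.Integer using (ℤ; +_; -_; _-_; _*_)
open import Data.Integer.Properties using (*-distribˡ-+)
open import Data.Product using (_×_; _,_; proj₁; proj₂)
open import Function.Bundles using (_⇔_; mk⇔)
open import Relation.Binary.PropositionalEquality using (_≡_; sym; cong; subst)

theorem5p3 : ∀ {c ℓ} (K : FiniteGroup c ℓ) (v k : ℕ) (β : ℤ) (P : FiniteGroup.Subset K) →
  FiniteGroup.RespectsEq K P →
  P (FiniteGroup.ε K) ≡ false →
  FiniteGroup.IsPartialSumSet K v k (β - + 1) β P →
  let G  = K ×C₂
      z  = (FiniteGroup.ε K , true)
      Pz = λ (g : FiniteGroup.Carrier G) → P (proj₁ g) ∧ proj₂ g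
      P₁ = λ (g : FiniteGroup.Carrier G) → P (proj₁ g) ∧ not (proj₂ g)
      S  = FiniteGroup._∪_ G P₁ Pz
      N  = FiniteGroup._∪_ G (FiniteGroup.⟨_⟩ G (FiniteGroup.ε G)) (FiniteGroup.⟨_⟩ G z)
      T₁ = FiniteGroup._∪_ G S (FiniteGroup.⟨_⟩ G (FiniteGroup.ε G))
      Tz = FiniteGroup._∪_ G S (FiniteGroup.⟨_⟩ G z)
      PPinv = + FiniteGroup.size K (FiniteGroup._∩_ K P (FiniteGroup.inverseSet K P))
  in (FiniteGroup.IsPartialSumSet G (2 ℕ.* v) (2 ℕ.* k) (+ 2 * β - + 2) (+ 2 * β) S ⇔ PPinv ≡ β)
     × (PPinv ≡ β →
          (FiniteGroup.IsSumSet G (2 ℕ.* v) (2 ℕ.* k ℕ.+ 1) (+ 2 * β) T₁ × FiniteGroup.IsType2 G N T₁)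
        × (FiniteGroup.IsSumSet G (2 ℕ.* v) (2 ℕ.* k ℕ.+ 1) (+ 2 * β) Tz × FiniteGroup.IsType2 G N Tz))
theorem5p3 K v k β P P-resp ε∉P P-isPartialSumSet =
  mk⇔ (λ S-pss → lift-isPartialSumSet⇒size∩inverseSet P-resp ε∉P
                   (G.isPartialSumSet-cong (P∪Pz≗lift P) S-pss))
      (λ ∣P∩P⁻¹∣≡β → G.isPartialSumSet-cong (λ g → sym (P∪Pz≗lift P g))
                       (liftP-isPartialSumSet ∣P∩P⁻¹∣≡β)) ,
  λ ∣P∩P⁻¹∣≡β → adjoin-isSumSet-isType2 false ∣P∩P⁻¹∣≡β ,
                adjoin-isSumSet-isType2 true ∣P∩P⁻¹∣≡β
  where
  open DirectProductC₂ K
  module K = FiniteGroup K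
  module G where
    open FiniteGroup (K ×C₂) public
    open FiniteGroupProperties (K ×C₂) public

  liftP-isPartialSumSet : + K.size (P K.∩ K.inverseSet P) ≡ β →
    G.IsPartialSumSet (2 ℕ.* v) (2 ℕ.* k) (+ 2 * β - + 2) (+ 2 * β) (lift P)
  liftP-isPartialSumSet ∣P∩P⁻¹∣≡β =
    subst (λ lam → G.IsPartialSumSet (2 ℕ.* v) (2 ℕ.* k) lam (+ 2 * β) (lift P))
          (*-distribˡ-+ (+ 2) β (- + 1))
          (isPartialSumSet-lift P-resp ε∉P P-isPartialSumSet ∣P∩P⁻¹∣≡β)

  adjoin-isSumSet-isType2 : ∀ b → + K.size (P K.∩ K.inverseSet P) ≡ β →
    let T = P∪Pz P G.∪ G.⟨ (K.ε , b) ⟩ in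
    G.IsSumSet (2 ℕ.* v) (2 ℕ.* k ℕ.+ 1) (+ 2 * β) T × G.IsType2 N T
  adjoin-isSumSet-isType2 b ∣P∩P⁻¹∣≡β =
    G.isPartialSumSet-cong lift∪≗S∪ (lift-∪-isSumSet P-resp ε∉P b (liftP-isPartialSumSet ∣P∩P⁻¹∣≡β)) ,
    G.isType2-cong lift∪≗S∪ (lift-∪-isType2 P-resp ε∉P b)
    where
    lift∪≗S∪ : ∀ g → (lift P G.∪ G.⟨ (K.ε , b) ⟩) g ≡ (P∪Pz P G.∪ G.⟨ (K.ε , b) ⟩) g
    lift∪≗S∪ g = cong (_∨ G.⟨ (K.ε , b) ⟩ g) (sym (P∪Pz≗lift P g))
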